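{- Let $\lambda=(a_1^{n_1}a_2^{n_2}\cdots a_s^{n_s})$ with $a_1>\dots>a_s>0$ and multiplicities $n_i>0$. Let $\vec n=(n_1,\dots,n_s)$ be the multiplicity type of $\lambda$ and $\vec p=(p_1,\dots,p_s)$ the multiplicity type of the conjugate $\lambda'$. Then the rectangular filtration $(R_1,\dots,R_s)$ of $\lambda$ is given by $R_i=\big((p_i^*)^{\,n_i^*}\big)$, the rectangle with $n_i^*$ rows of length $p_i^*$, for $i=1,\dots,s$.
   Context: **Multiplicity type.** For a partition $\lambda=(a_1^{n_1}\cdots a_s^{n_s})$ with distinct parts $a_1>\dots>a_s>0$ of multiplicities $n_i>0$, its multiplicity type is the vector $(n_1,\dots,n_s)$. **Starred vector.** For $\vec n=(n_1,\dots,n_s)\in\mathbb{Z}^s$ define $\vec n^*=(n_1^*,\dots,n_s^*)$ by $$n^*_{2i+1}=\sum_{i<j<s-i+1}n_j,\qquad n^*_{2i}=\sum_{i<j\le s-i+1}n_j.$$ **Complement.** For $\nu\subset(r^s)$ padded to $(\nu_1,\dots,\nu_s)$, set $(r^s)-'\nu=(r-\nu_s,\dots,r-\nu_1)$, with zero parts dropped. **Rectangular filtration.** For a nonzero partition $\lambda$ put $\mathfrak{R}(\lambda)=(\lambda_1^{\,l(\lambda)})$ and $\mathfrak{C}(\lambda)=\mathfrak{R}(\lambda)-'\lambda$. If $\lambda$ has $s$ distinct nonzero parts, its rectangular filtration is $(R_1,\dots,R_s)$ with $R_i=\mathfrak{R}(\mathfrak{C}^{i-1}(\lambda))$ and $\mathfrak{C}^0(\lambda)=\lambda$.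 -}

module Defs where

open import Data.Nat using (ℕ; zero; suc; _+_; _∸_; _≤?_; _<_; _%_; ⌊_/2⌋)
open import Data.Nat.Properties using (_≟_)
open import Data.List using (List; []; _∷_; map; filter; length; upTo; replicate; reverse; _++_; concatMap)
open import Data.Product using (_×_; _,_; proj₂)
open import Data.Fin using (Fin)
open import Data.Nat.ListAction using (sum)
open import Data.List using () renaming (allFin to allFinL)
open import Relation.Nullary using (yes; no; ¬?)

-- Partitions are represented as weakly decreasing lists of positive naturals
-- (largest part first).

build : {s : ℕ} → (Fin s → ℕ) → (Fin s → ℕ) → List ℕ
build {s} a n = concatMap (λ i → replicate (n i) (a i)) (allFinL s)

headOr0 : List ℕ → ℕ
headOr0 []      = 0
headOr0 (x ∷ _) = x

conj : List ℕ → List ℕ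
conj lam = map (λ j → length (filter (λ x → suc j ≤? x) lam)) (upTo (headOr0 lam))

rle : List ℕ → List (ℕ × ℕ)
rle [] = []
rle (x ∷ xs) with rle xs
... | [] = (x , 1) ∷ []
... | (y , c) ∷ rest with x ≟ y
...   | yes _ = (y , suc c) ∷ rest
...   | no  _ = (x , 1) ∷ (y , c) ∷ rest

multType : List ℕ → List ℕ
multType lam = map proj₂ (rle lam)

-- 1-based lookup with default 0
nth : List ℕ → ℕ → ℕ
nth []       _             = 0
nth (x ∷ xs) zero          = 0
nth (x ∷ xs) (suc zero)    = x
nth (x ∷ xs) (suc (suc k)) = nth xs (suc k)

sumFromTo : List ℕ → ℕ → ℕ → ℕ
sumFromTo v lo hi = sum (map (λ t → nth v (lo + t)) (upTo (suc hi ∸ lo)))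

-- starred vector, 1-based component k:
--   n*_{2i+1} = sum_{i<j<s-i+1} n_j ,   n*_{2i} = sum_{i<j≤s-i+1} n_j
star : List ℕ → ℕ → ℕ
star v k with k % 2
... | 0 = sumFromTo v (suc ⌊ k /2⌋) (suc (length v ∸ ⌊ k /2⌋))
... | _ = sumFromTo v (suc ⌊ k /2⌋) (length v ∸ ⌊ k /2⌋)

rect : List ℕ → List ℕ
rect lam = replicate (length lam) (headOr0 lam)

compl : ℕ → ℕ → List ℕ → List ℕ
compl r s ν = filter (λ x → ¬? (x ≟ 0)) (reverse (map (r ∸_) (ν ++ replicate (s ∸ length ν) 0)))

C : List ℕ → List ℕ
C lam = compl (headOr0 lam) (length lam) lam

iterC : ℕ → List ℕ → List ℕ
iterC zero    lam = lam
iterC (suc k) lam = C (iterC k lam)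

-- rectangular filtration, 1-based index i: R_i = 𝔑(ℭ^{i-1}(λ))
filtration : List ℕ → ℕ → List ℕ
filtration lam i = rect (iterC (i ∸ 1) lam)

-- Encode a partition λ by its multiplicity type n and the multiplicity type p of its conjugate;
-- for λ = (a₁^{n₁} ⋯ aₛ^{nₛ}) this is p = (aₛ, aₛ₋₁ − aₛ, …, a₁ − a₂), and conjugation swaps n and p.
-- The bounding rectangle of λ is ((p₁ + ⋯ + pₛ)^{n₁ + ⋯ + nₛ}), and complementing λ in it deletes the
-- first row block and replaces (n, p) by ((nₛ, …, n₂), (pₛ, …, p₂)). The starred vector obeys the
-- same recursion: v*₁ = v₁ + ⋯ + vₛ and v*_{k+2} = (vₛ, …, v₂)*_{k+1}. Induction on i then gives
-- R_i = ℜ(ℭ^{i−1}(λ)) = ((p_i*)^{n_i*}).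

module Submission where

open import Defs
open import Data.Nat using (ℕ; zero; suc; _+_; _∸_; _≤_; _<_; _>_; _≥_; s≤s; z<s; s<s; ⌊_/2⌋; _%_)
open import Data.Nat.Properties
open import Data.Nat.ListAction using (sum)
open import Data.Nat.ListAction.Properties using (sum-++; sum-↭)
open import Data.List using (concat; allFin; tabulate; filter; initLast; _∷ʳ′_; List; []; _∷_; map; length; upTo; applyUpTo; take; drop; reverse; _++_; _∷ʳ_; replicate)
open import Data.List.Properties using (map-tabulate; length-map; length-tabulate; map-cong; filter-++; filter-all; filter-none; map-∘; length-++; length-replicate; map-replicate; map-++; ++-identityʳ; map-upTo; drop-[]; take-[]; take-all; length-reverse; reverse-++; unfold-reverse; take++drop≡id; length-take; length-drop; ++-assoc; reverse-involutive)
open import Data.List.Relation.Unary.All as All using (All; []; _∷_)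
open import Data.List.Relation.Unary.All.Properties using (++⁺; ++⁻ʳ; replicate⁺; map⁺; drop⁺; tabulate⁺)
open import Data.List.Relation.Unary.Linked as Linked using (Linked; []; [-]; _∷_)
open import Data.List.Relation.Binary.Permutation.Propositional using (↭-sym)
open import Data.List.Relation.Binary.Permutation.Propositional.Properties using (↭-reverse; All-resp-↭)
open import Algebra.Properties.CommutativeSemigroup +-commutativeSemigroup using (x∙yz≈y∙xz)
open import Data.Product using (Σ; _×_; _,_; proj₁; proj₂)
open import Data.Fin using (Fin; toℕ) renaming (zero to fzero; suc to fsuc)
open import Data.Fin.Properties using (toℕ<n)
open import Function using (_∘_; id)
open import Relation.Nullary using (¬_; ¬?; yes; no; contradiction)
open import Relation.Binary.PropositionalEquality

private
  variable
    A : Set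

sum-reverse : ∀ xs → sum (reverse xs) ≡ sum xs
sum-reverse xs = sum-↭ (↭-reverse xs)

sum-∷ʳ : ∀ xs x → sum (xs ∷ʳ x) ≡ x + sum xs
sum-∷ʳ xs x = trans (sum-++ xs (x ∷ [])) (trans (cong (sum xs +_) (+-identityʳ x)) (+-comm (sum xs) x))

length-∷ʳ : ∀ (xs : List A) x → length (xs ∷ʳ x) ≡ suc (length xs)
length-∷ʳ xs x = trans (length-++ xs) (+-comm (length xs) 1)

All-reverse : ∀ {P : A → Set} xs → All P xs → All P (reverse xs)
All-reverse xs = All-resp-↭ (↭-sym (↭-reverse xs))

take-length-++ : ∀ (xs ys : List A) → take (length xs) (xs ++ ys) ≡ xs
take-length-++ []       ys = refl
take-length-++ (x ∷ xs) ys = cong (x ∷_) (take-length-++ xs ys)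

reverse-++₃ : ∀ (P M Q : List A) → reverse (P ++ M ++ Q) ≡ reverse Q ++ reverse M ++ reverse P
reverse-++₃ P M Q = begin
  reverse (P ++ M ++ Q)                    ≡⟨ reverse-++ P (M ++ Q) ⟩
  reverse (M ++ Q) ++ reverse P            ≡⟨ cong (_++ reverse P) (reverse-++ M Q) ⟩
  (reverse Q ++ reverse M) ++ reverse P    ≡⟨ ++-assoc (reverse Q) (reverse M) (reverse P) ⟩
  reverse Q ++ reverse M ++ reverse P      ∎
  where open ≡-Reasoning

replicate-∷ʳ : ∀ n (x : A) → replicate n x ∷ʳ x ≡ x ∷ replicate n x
replicate-∷ʳ zero    x = refl
replicate-∷ʳ (suc n) x = cong (x ∷_) (replicate-∷ʳ n x)

reverse-replicate : ∀ n (x : A) → reverse (replicate n x) ≡ replicate n x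
reverse-replicate zero    x = refl
reverse-replicate (suc n) x =
  trans (unfold-reverse x (replicate n x)) (trans (cong (_∷ʳ x) (reverse-replicate n x)) (replicate-∷ʳ n x))

applyUpTo-+ : ∀ (f : ℕ → A) m k → applyUpTo f (m + k) ≡ applyUpTo f m ++ applyUpTo (f ∘ (m +_)) k
applyUpTo-+ f zero    k = refl
applyUpTo-+ f (suc m) k = cong (f 0 ∷_) (applyUpTo-+ (f ∘ suc) m k)

applyUpTo-cong : ∀ (f g : ℕ → A) m → (∀ t → t < m → f t ≡ g t) → applyUpTo f m ≡ applyUpTo g m
applyUpTo-cong f g zero    f≗g = refl
applyUpTo-cong f g (suc m) f≗g =
  cong₂ _∷_ (f≗g 0 z<s) (applyUpTo-cong (f ∘ suc) (g ∘ suc) m (λ t t<m → f≗g (suc t) (s<s t<m)))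

applyUpTo-const : ∀ (c : A) m → applyUpTo (λ _ → c) m ≡ replicate m c
applyUpTo-const c zero    = refl
applyUpTo-const c (suc m) = cong (c ∷_) (applyUpTo-const c m)

-- The starred vector

double : ℕ → ℕ
double zero    = zero
double (suc i) = suc (suc (double i))

double%2 : ∀ i → double i % 2 ≡ 0
double%2 zero    = refl
double%2 (suc i) = double%2 i

suc-double%2 : ∀ i → suc (double i) % 2 ≡ 1
suc-double%2 zero    = refl
suc-double%2 (suc i) = suc-double%2 i

⌊double/2⌋ : ∀ i → ⌊ double i /2⌋ ≡ i
⌊double/2⌋ zero    = refl
⌊double/2⌋ (suc i) = cong suc (⌊double/2⌋ i)

⌊suc-double/2⌋ : ∀ i → ⌊ suc (double i) /2⌋ ≡ i
⌊suc-double/2⌋ zero    = refl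
⌊suc-double/2⌋ (suc i) = cong suc (⌊suc-double/2⌋ i)

data Parity : ℕ → Set where
  even : ∀ i → Parity (double i)
  odd  : ∀ i → Parity (suc (double i))

parity : ∀ k → Parity k
parity zero = even zero
parity (suc k) with parity k
... | even i = odd i
... | odd i  = even (suc i)

window : ℕ → ℕ → List A → List A
window a b v = take (length v ∸ a ∸ b) (drop a v)

window-[] : ∀ a b → window {A = A} a b [] ≡ []
window-[] {A = A} a b rewrite drop-[] {A = A} a = take-[] (0 ∸ a ∸ b)

window-suc : ∀ a b (v : List A) → window (suc a) b v ≡ window a b (drop 1 v)
window-suc a b []      = trans (window-[] (suc a) b) (sym (window-[] a b))
window-suc a b (x ∷ v) = refl

window-++ : ∀ {a b} (P M Q : List A) → length P ≡ a → length Q ≡ b → window a b (P ++ M ++ Q) ≡ M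
window-++ (x ∷ P) M Q refl refl = window-++ P M Q refl refl
window-++ []      M Q refl refl = begin
  take (length (M ++ Q) ∸ length Q) (M ++ Q)        ≡⟨ cong (λ l → take (l ∸ length Q) (M ++ Q)) (length-++ M) ⟩
  take (length M + length Q ∸ length Q) (M ++ Q)    ≡⟨ cong (λ l → take l (M ++ Q)) (m+n∸n≡m (length M) (length Q)) ⟩
  take (length M) (M ++ Q)                          ≡⟨ take-length-++ M Q ⟩
  M                                                 ∎
  where open ≡-Reasoning

window-split : ∀ a b (w : List A) → a + b ≤ length w →
  Σ (List A) λ P → Σ (List A) λ Q → length P ≡ b × length Q ≡ a × w ≡ P ++ window b a w ++ Q
window-split a b w a+b≤ = take b w , drop m (drop b w) , length-P , length-Q , split
  where
  m = length w ∸ b ∸ a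
  length-P : length (take b w) ≡ b
  length-P = trans (length-take b w) (m≤n⇒m⊓n≡m (m+n≤o⇒n≤o a a+b≤))
  length-Q : length (drop m (drop b w)) ≡ a
  length-Q = trans (length-drop m (drop b w))
                   (trans (cong (_∸ m) (length-drop b w)) (m∸[m∸n]≡n (m+n≤o⇒m≤o∸n a a+b≤)))
  split : w ≡ take b w ++ take m (drop b w) ++ drop m (drop b w)
  split = sym (trans (cong (take b w ++_) (take++drop≡id m (drop b w))) (take++drop≡id b w))

window-reverse : ∀ a b (w : List A) → window a b (reverse w) ≡ reverse (window b a w)
window-reverse a b w with a + b ≤? length w
... | no a+b≰ = trans (cong (λ l → take l (drop a (reverse w))) short)
                      (sym (cong (λ l → reverse (take l (drop b w))) short′))
  where
  w<a+b : length w ≤ a + b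
  w<a+b = <⇒≤ (≰⇒> a+b≰)
  short : length (reverse w) ∸ a ∸ b ≡ 0
  short = trans (cong (λ l → l ∸ a ∸ b) (length-reverse w))
                (trans (∸-+-assoc (length w) a b) (m≤n⇒m∸n≡0 w<a+b))
  short′ : length w ∸ b ∸ a ≡ 0
  short′ = trans (∸-+-assoc (length w) b a) (m≤n⇒m∸n≡0 (≤-trans w<a+b (≤-reflexive (+-comm a b))))
... | yes a+b≤ with window-split a b w a+b≤
...   | P , Q , length-P , length-Q , w≡ = begin
  window a b (reverse w)                                      ≡⟨ cong (window a b ∘ reverse) w≡ ⟩
  window a b (reverse (P ++ window b a w ++ Q))               ≡⟨ cong (window a b) (reverse-++₃ P _ Q) ⟩
  window a b (reverse Q ++ reverse (window b a w) ++ reverse P)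
    ≡⟨ window-++ (reverse Q) _ (reverse P) (trans (length-reverse Q) length-Q) (trans (length-reverse P) length-P) ⟩
  reverse (window b a w)                                      ∎
  where open ≡-Reasoning

sum-nth : ∀ v a m → sum (applyUpTo (λ t → nth v (suc (a + t))) m) ≡ sum (take m (drop a v))
sum-nth []      a       m       rewrite drop-[] {A = ℕ} a | take-[] {A = ℕ} m = sum-zeros m
  where
  sum-zeros : ∀ m → sum (applyUpTo (λ _ → 0) m) ≡ 0
  sum-zeros zero    = refl
  sum-zeros (suc m) = sum-zeros m
sum-nth (x ∷ v) (suc a) m       = sum-nth v a m
sum-nth (x ∷ v) zero    zero    = refl
sum-nth (x ∷ v) zero    (suc m) = cong (x +_) (sum-nth v zero m)

sumFromTo-drop : ∀ v a hi → sumFromTo v (suc a) hi ≡ sum (take (hi ∸ a) (drop a v))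
sumFromTo-drop v a hi
  rewrite map-upTo (λ t → nth v (suc a + t)) (hi ∸ a) = sum-nth v a (hi ∸ a)

star-odd : ∀ v i → star v (suc (double i)) ≡ sum (window i i v)
star-odd v i rewrite suc-double%2 i | ⌊suc-double/2⌋ i = sumFromTo-drop v i (length v ∸ i)

star-even : ∀ v i → star v (double (suc i)) ≡ sum (window (suc i) i v)
star-even v i rewrite double%2 i | ⌊double/2⌋ i =
  sumFromTo-drop v (suc i) (suc (length v ∸ suc i))

star-1 : ∀ v → star v 1 ≡ sum v
star-1 v = trans (star-odd v 0) (cong sum (take-all (length v) v ≤-refl))

shrink : List A → List A
shrink v = reverse (drop 1 v)

length-shrink : ∀ (v : List A) → length (shrink v) ≡ length v ∸ 1
length-shrink v = trans (length-reverse (drop 1 v)) (length-drop 1 v)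

All-shrink : ∀ {P : A → Set} v → All P v → All P (shrink v)
All-shrink v pv = All-reverse (drop 1 v) (drop⁺ 1 pv)

sum-window-shrink : ∀ a b v → sum (window a b (shrink v)) ≡ sum (window (suc b) a v)
sum-window-shrink a b v = begin
  sum (window a b (reverse (drop 1 v)))   ≡⟨ cong sum (window-reverse a b (drop 1 v)) ⟩
  sum (reverse (window b a (drop 1 v)))   ≡⟨ sum-reverse (window b a (drop 1 v)) ⟩
  sum (window b a (drop 1 v))             ≡⟨ cong sum (window-suc b a v) ⟨
  sum (window (suc b) a v)                ∎
  where open ≡-Reasoning

star-suc-suc : ∀ v k → star v (suc (suc k)) ≡ star (shrink v) (suc k)
star-suc-suc v k with parity k
... | even i = trans (star-even v i) (sym (trans (star-odd (shrink v) i) (sum-window-shrink i i v)))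
... | odd i  = trans (star-odd v (suc i)) (sym (trans (star-even (shrink v) i) (sum-window-shrink (suc i) i v)))

-- Row blocks

All-rle : ∀ {P : ℕ → Set} xs → All P xs → All (P ∘ proj₁) (rle xs)
All-rle []       []         = []
All-rle (x ∷ xs) (px ∷ pxs) with rle xs | All-rle xs pxs
... | []             | _          = px ∷ []
... | (y , c) ∷ rest | py ∷ prest with x ≟ y
...   | yes _ = py ∷ prest
...   | no  _ = px ∷ py ∷ prest

rle-block : ∀ x c R → All (_< x) R → rle (replicate (suc c) x ++ R) ≡ (x , suc c) ∷ rle R
rle-block x zero R R<x with rle R | All-rle R R<x
... | []             | _         = refl
... | (y , c) ∷ rest | y<x ∷ _ with x ≟ y
...   | yes refl = contradiction y<x (<-irrefl refl)
...   | no  _    = refl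
rle-block x (suc c) R R<x rewrite rle-block x c R R<x with x ≟ x
... | yes _   = refl
... | no  x≢x = contradiction refl x≢x

countAbove : List ℕ → ℕ → ℕ
countAbove L j = length (filter (λ x → suc j ≤? x) L)

countAbove-++ : ∀ xs ys j → countAbove (xs ++ ys) j ≡ countAbove xs j + countAbove ys j
countAbove-++ xs ys j =
  trans (cong length (filter-++ (λ x → suc j ≤? x) xs ys)) (length-++ (filter (λ x → suc j ≤? x) xs))

countAbove-replicate : ∀ c x j → j < x → countAbove (replicate c x) j ≡ c
countAbove-replicate c x j j<x =
  trans (cong length (filter-all (λ y → suc j ≤? y) (replicate⁺ c j<x))) (length-replicate c)

countAbove-≤ : ∀ L j → All (_≤ j) L → countAbove L j ≡ 0
countAbove-≤ L j L≤j = cong length (filter-none (λ y → suc j ≤? y) (All.map ≤⇒≯ L≤j))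

conj-block : ∀ c x R → 0 < c → All (_≤ headOr0 R) R → headOr0 R ≤ x →
  conj (replicate c x ++ R) ≡ map (c +_) (conj R) ++ replicate (x ∸ headOr0 R) c
conj-block (suc c′) x R _ R≤h h≤x = begin
  conj L
    ≡⟨ map-upTo (countAbove L) x ⟩
  applyUpTo (countAbove L) x
    ≡⟨ cong (applyUpTo (countAbove L)) (m+[n∸m]≡n h≤x) ⟨
  applyUpTo (countAbove L) (h + (x ∸ h))
    ≡⟨ applyUpTo-+ (countAbove L) h (x ∸ h) ⟩
  applyUpTo (countAbove L) h ++ applyUpTo (countAbove L ∘ (h +_)) (x ∸ h)
    ≡⟨ cong₂ _++_ lower upper ⟩
  map (c +_) (conj R) ++ replicate (x ∸ h) c
    ∎
  where
  open ≡-Reasoning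
  c = suc c′
  h = headOr0 R
  L = replicate c x ++ R
  lower : applyUpTo (countAbove L) h ≡ map (c +_) (conj R)
  lower = begin
    applyUpTo (countAbove L) h
      ≡⟨ applyUpTo-cong _ _ h (λ t t<h → trans (countAbove-++ (replicate c x) R t)
                                        (cong (_+ countAbove R t) (countAbove-replicate c x t (<-≤-trans t<h h≤x)))) ⟩
    applyUpTo (λ t → c + countAbove R t) h
      ≡⟨ map-upTo (λ t → c + countAbove R t) h ⟨
    map (λ t → c + countAbove R t) (upTo h)
      ≡⟨ map-∘ (upTo h) ⟩
    map (c +_) (conj R)
      ∎
  upper : applyUpTo (countAbove L ∘ (h +_)) (x ∸ h) ≡ replicate (x ∸ h) c
  upper = trans (applyUpTo-cong _ _ (x ∸ h) column) (applyUpTo-const c (x ∸ h))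
    where
    column : ∀ t → t < x ∸ h → countAbove L (h + t) ≡ c
    column t t<x∸h = begin
      countAbove L (h + t)
        ≡⟨ countAbove-++ (replicate c x) R (h + t) ⟩
      countAbove (replicate c x) (h + t) + countAbove R (h + t)
        ≡⟨ cong₂ _+_ (countAbove-replicate c x (h + t) h+t<x)
                     (countAbove-≤ R (h + t) (All.map (λ p → ≤-trans p (m≤m+n h t)) R≤h)) ⟩
      c + 0
        ≡⟨ +-identityʳ c ⟩
      c ∎
      where
      h+t<x : h + t < x
      h+t<x = subst (h + t <_) (m+[n∸m]≡n h≤x) (+-monoʳ-< h t<x∸h)

C-block : ∀ c x R → 0 < c → All (_< x) R → C (replicate c x ++ R) ≡ reverse (map (x ∸_) R)
C-block (suc c′) x R _ R<x = begin
  filter nonzero? (reverse (map (x ∸_) (L ++ replicate (length L ∸ length L) 0)))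
    ≡⟨ cong (λ k → filter nonzero? (reverse (map (x ∸_) (L ++ replicate k 0)))) (n∸n≡0 (length L)) ⟩
  filter nonzero? (reverse (map (x ∸_) (L ++ [])))
    ≡⟨ cong (λ l → filter nonzero? (reverse (map (x ∸_) l))) (++-identityʳ L) ⟩
  filter nonzero? (reverse (map (x ∸_) L))
    ≡⟨ cong (filter nonzero? ∘ reverse) (map-++ (x ∸_) (replicate c x) R) ⟩
  filter nonzero? (reverse (map (x ∸_) (replicate c x) ++ map (x ∸_) R))
    ≡⟨ cong (filter nonzero?) (reverse-++ (map (x ∸_) (replicate c x)) (map (x ∸_) R)) ⟩
  filter nonzero? (reverse (map (x ∸_) R) ++ reverse (map (x ∸_) (replicate c x)))
    ≡⟨ filter-++ nonzero? (reverse (map (x ∸_) R)) _ ⟩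
  filter nonzero? (reverse (map (x ∸_) R)) ++ filter nonzero? (reverse (map (x ∸_) (replicate c x)))
    ≡⟨ cong₂ _++_ (filter-all nonzero? (All-reverse _ positive)) (filter-none nonzero? (All-reverse _ zeros)) ⟩
  reverse (map (x ∸_) R) ++ []
    ≡⟨ ++-identityʳ _ ⟩
  reverse (map (x ∸_) R)
    ∎
  where
  open ≡-Reasoning
  c = suc c′
  L = replicate c x ++ R
  nonzero? = λ (y : ℕ) → ¬? (y ≟ 0)
  positive : All (λ y → y ≢ 0) (map (x ∸_) R)
  positive = map⁺ (All.map (n>0⇒n≢0 ∘ m<n⇒0<n∸m) R<x)
  zeros : All (λ y → ¬ (y ≢ 0)) (map (x ∸_) (replicate c x))
  zeros = subst (All (λ y → ¬ (y ≢ 0))) (sym (map-replicate (x ∸_) c x)) (replicate⁺ c (λ x∸x≢0 → x∸x≢0 (n∸n≡0 x)))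

iterC-suc : ∀ k L → iterC (suc k) L ≡ iterC k (C L)
iterC-suc zero    L = refl
iterC-suc (suc k) L = cong C (iterC-suc k L)

-- Partitions with prescribed multiplicity types

fromGaps : List ℕ → List ℕ → List ℕ
fromGaps []       _        = []
fromGaps (_ ∷ _)  []       = []
fromGaps (d ∷ ds) (m ∷ ms) = replicate m (d + sum ds) ++ fromGaps ds ms

length-fromGaps : ∀ ds ms → length ds ≡ length ms → length (fromGaps ds ms) ≡ sum ms
length-fromGaps []       []       _  = refl
length-fromGaps (d ∷ ds) (m ∷ ms) eq =
  trans (length-++ (replicate m (d + sum ds)))
        (cong₂ _+_ (length-replicate m) (length-fromGaps ds ms (suc-injective eq)))

headOr0-fromGaps : ∀ ds ms → length ds ≡ length ms → All (0 <_) ms → headOr0 (fromGaps ds ms) ≡ sum ds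
headOr0-fromGaps []       []          _ _ = refl
headOr0-fromGaps (d ∷ ds) (suc m ∷ _) _ _ = refl
headOr0-fromGaps (d ∷ ds) (zero ∷ _)  _ (() ∷ _)

fromGaps-≤ : ∀ ds ms → All (_≤ sum ds) (fromGaps ds ms)
fromGaps-≤ []       _        = []
fromGaps-≤ (d ∷ ds) []       = []
fromGaps-≤ (d ∷ ds) (m ∷ ms) =
  ++⁺ (replicate⁺ m ≤-refl) (All.map (λ p → ≤-trans p (m≤n+m (sum ds) d)) (fromGaps-≤ ds ms))

fromGaps-∷ʳ : ∀ ds ms d m → length ds ≡ length ms →
  fromGaps (ds ∷ʳ d) (ms ∷ʳ m) ≡ map (d +_) (fromGaps ds ms) ++ replicate m d
fromGaps-∷ʳ []        []        d m _  = trans (++-identityʳ _) (cong (replicate m) (+-identityʳ d))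
fromGaps-∷ʳ (d′ ∷ ds) (m′ ∷ ms) d m eq = begin
  replicate m′ (d′ + sum (ds ∷ʳ d)) ++ fromGaps (ds ∷ʳ d) (ms ∷ʳ m)
    ≡⟨ cong₂ _++_ (cong (replicate m′) shift) (fromGaps-∷ʳ ds ms d m (suc-injective eq)) ⟩
  replicate m′ (d + (d′ + sum ds)) ++ map (d +_) (fromGaps ds ms) ++ replicate m d
    ≡⟨ cong (_++ _) (map-replicate (d +_) m′ (d′ + sum ds)) ⟨
  map (d +_) (replicate m′ (d′ + sum ds)) ++ map (d +_) (fromGaps ds ms) ++ replicate m d
    ≡⟨ ++-assoc (map (d +_) (replicate m′ (d′ + sum ds))) _ _ ⟨
  (map (d +_) (replicate m′ (d′ + sum ds)) ++ map (d +_) (fromGaps ds ms)) ++ replicate m d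
    ≡⟨ cong (_++ replicate m d) (map-++ (d +_) (replicate m′ (d′ + sum ds)) _) ⟨
  map (d +_) (replicate m′ (d′ + sum ds) ++ fromGaps ds ms) ++ replicate m d
    ∎
  where
  open ≡-Reasoning
  shift : d′ + sum (ds ∷ʳ d) ≡ d + (d′ + sum ds)
  shift = begin
    d′ + sum (ds ∷ʳ d)   ≡⟨ cong (d′ +_) (sum-∷ʳ ds d) ⟩
    d′ + (d + sum ds)    ≡⟨ x∙yz≈y∙xz d′ d (sum ds) ⟩
    d + (d′ + sum ds)    ∎

multType-fromGaps : ∀ ds ms → length ds ≡ length ms → All (0 <_) ds → All (0 <_) ms →
  multType (fromGaps ds ms) ≡ ms
multType-fromGaps []       []           _  _          _        = refl
multType-fromGaps (d ∷ ds) (zero ∷ ms)  _  _          (() ∷ _)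
multType-fromGaps (d ∷ ds) (suc m ∷ ms) eq (0<d ∷ pd) (_ ∷ pm) = begin
  map proj₂ (rle (replicate (suc m) (d + sum ds) ++ fromGaps ds ms))
    ≡⟨ cong (map proj₂) (rle-block (d + sum ds) m (fromGaps ds ms) below) ⟩
  suc m ∷ multType (fromGaps ds ms)
    ≡⟨ cong (suc m ∷_) (multType-fromGaps ds ms (suc-injective eq) pd pm) ⟩
  suc m ∷ ms ∎
  where
  open ≡-Reasoning
  below : All (_< d + sum ds) (fromGaps ds ms)
  below = All.map (λ p → <-≤-trans (s≤s p) (+-monoˡ-≤ (sum ds) 0<d)) (fromGaps-≤ ds ms)

conj-fromGaps : ∀ ds ms → length ds ≡ length ms → All (0 <_) ms →
  conj (fromGaps ds ms) ≡ fromGaps (reverse ms) (reverse ds)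
conj-fromGaps []       []       _  _           = refl
conj-fromGaps (d ∷ ds) (m ∷ ms) eq (0<m ∷ pm) = begin
  conj (replicate m (d + sum ds) ++ R)
    ≡⟨ conj-block m (d + sum ds) R 0<m R≤h h≤x ⟩
  map (m +_) (conj R) ++ replicate (d + sum ds ∸ headOr0 R) m
    ≡⟨ cong₂ (λ u k → map (m +_) u ++ replicate k m)
             (conj-fromGaps ds ms eq′ pm)
             (trans (cong (d + sum ds ∸_) h≡) (m+n∸n≡m d (sum ds))) ⟩
  map (m +_) (fromGaps (reverse ms) (reverse ds)) ++ replicate d m
    ≡⟨ fromGaps-∷ʳ (reverse ms) (reverse ds) m d
                   (trans (length-reverse ms) (trans (sym eq′) (sym (length-reverse ds)))) ⟨
  fromGaps (reverse ms ∷ʳ m) (reverse ds ∷ʳ d)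
    ≡⟨ cong₂ fromGaps (unfold-reverse m ms) (unfold-reverse d ds) ⟨
  fromGaps (reverse (m ∷ ms)) (reverse (d ∷ ds))
    ∎
  where
  open ≡-Reasoning
  R = fromGaps ds ms
  eq′ = suc-injective eq
  h≡ : headOr0 R ≡ sum ds
  h≡ = headOr0-fromGaps ds ms eq′ pm
  R≤h : All (_≤ headOr0 R) R
  R≤h = subst (λ h → All (_≤ h) R) (sym h≡) (fromGaps-≤ ds ms)
  h≤x : headOr0 R ≤ d + sum ds
  h≤x = subst (_≤ d + sum ds) (sym h≡) (m≤n+m (sum ds) d)

-- The partition with multiplicity type ms whose conjugate has multiplicity type ps.
fromTypes : List ℕ → List ℕ → List ℕ
fromTypes ms ps = fromGaps (reverse ps) ms

length-reverse-≡ : ∀ (xs ys : List ℕ) → length xs ≡ length ys → length (reverse ys) ≡ length xs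
length-reverse-≡ xs ys eq = trans (length-reverse ys) (sym eq)

multType-fromTypes : ∀ ms ps → length ms ≡ length ps → All (0 <_) ms → All (0 <_) ps →
  multType (fromTypes ms ps) ≡ ms
multType-fromTypes ms ps eq pm pp =
  multType-fromGaps (reverse ps) ms (length-reverse-≡ ms ps eq) (All-reverse ps pp) pm

conj-fromTypes : ∀ ms ps → length ms ≡ length ps → All (0 <_) ms → conj (fromTypes ms ps) ≡ fromTypes ps ms
conj-fromTypes ms ps eq pm =
  trans (conj-fromGaps (reverse ps) ms (length-reverse-≡ ms ps eq) pm)
        (cong (fromGaps (reverse ms)) (reverse-involutive ps))

rect-fromTypes : ∀ ms ps → length ms ≡ length ps → All (0 <_) ms → rect (fromTypes ms ps) ≡ replicate (sum ms) (sum ps)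
rect-fromTypes ms ps eq pm =
  cong₂ replicate (length-fromGaps (reverse ps) ms (length-reverse-≡ ms ps eq))
                  (trans (headOr0-fromGaps (reverse ps) ms (length-reverse-≡ ms ps eq) pm) (sum-reverse ps))

fromTypes-≤ : ∀ ms ps → All (_≤ sum ps) (fromTypes ms ps)
fromTypes-≤ ms ps = subst (λ h → All (_≤ h) (fromTypes ms ps)) (sum-reverse ps) (fromGaps-≤ (reverse ps) ms)

fromTypes-∷ʳ : ∀ ms ps m p → length ms ≡ length ps →
  fromTypes (ms ∷ʳ m) (p ∷ ps) ≡ map (p +_) (fromTypes ms ps) ++ replicate m p
fromTypes-∷ʳ ms ps m p eq rewrite unfold-reverse p ps =
  fromGaps-∷ʳ (reverse ps) ms p m (length-reverse-≡ ms ps eq)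

fromTypes-∷-∷ʳ : ∀ m ms ps x → fromTypes (m ∷ ms) (ps ∷ʳ x) ≡ replicate m (sum (ps ∷ʳ x)) ++ fromTypes ms ps
fromTypes-∷-∷ʳ m ms ps x rewrite reverse-++ ps (x ∷ []) =
  cong (λ h → replicate m h ++ fromTypes ms ps) (trans (cong (x +_) (sum-reverse ps)) (sym (sum-∷ʳ ps x)))

fromTypes-∷-reverse : ∀ m ms ps x →
  fromTypes (m ∷ ms) (reverse (ps ∷ʳ x)) ≡ replicate m (x + sum ps) ++ fromTypes ms (shrink (ps ∷ʳ x))
fromTypes-∷-reverse m ms []       x = refl
fromTypes-∷-reverse m ms (w ∷ ps) x rewrite reverse-involutive (w ∷ ps ∷ʳ x) | reverse-involutive (ps ∷ʳ x) =
  cong (λ h → replicate m h ++ fromGaps (ps ∷ʳ x) ms) (sum-∷ʳ (w ∷ ps) x)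

complement-fromTypes : ∀ x ps rms → length rms ≡ length ps →
  reverse (map ((x + sum ps) ∸_) (fromTypes (reverse rms) ps)) ≡ fromTypes rms (shrink (ps ∷ʳ x))
complement-fromTypes x []       []        _  = refl
complement-fromTypes x (z ∷ ps) (y ∷ rms) eq = begin
  reverse (map (H ∸_) (fromTypes (reverse (y ∷ rms)) (z ∷ ps)))
    ≡⟨ cong (λ l → reverse (map (H ∸_) (fromTypes l (z ∷ ps)))) (unfold-reverse y rms) ⟩
  reverse (map (H ∸_) (fromTypes (reverse rms ∷ʳ y) (z ∷ ps)))
    ≡⟨ cong (reverse ∘ map (H ∸_)) (fromTypes-∷ʳ (reverse rms) ps y z (trans (length-reverse rms) eq′)) ⟩
  reverse (map (H ∸_) (map (z +_) F ++ replicate y z))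
    ≡⟨ cong reverse (map-++ (H ∸_) (map (z +_) F) (replicate y z)) ⟩
  reverse (map (H ∸_) (map (z +_) F) ++ map (H ∸_) (replicate y z))
    ≡⟨ cong reverse (cong₂ _++_ shifted top) ⟩
  reverse (map (H′ ∸_) F ++ replicate y H′)
    ≡⟨ reverse-++ (map (H′ ∸_) F) (replicate y H′) ⟩
  reverse (replicate y H′) ++ reverse (map (H′ ∸_) F)
    ≡⟨ cong₂ _++_ (reverse-replicate y H′) (complement-fromTypes x ps rms eq′) ⟩
  replicate y H′ ++ fromTypes rms (shrink (ps ∷ʳ x))
    ≡⟨ fromTypes-∷-reverse y rms ps x ⟨
  fromTypes (y ∷ rms) (reverse (ps ∷ʳ x))
    ∎
  where
  open ≡-Reasoning
  H′ = x + sum ps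
  H  = x + (z + sum ps)
  F  = fromTypes (reverse rms) ps
  eq′ = suc-injective eq
  H≡ : H ≡ z + H′
  H≡ = x∙yz≈y∙xz x z (sum ps)
  shifted : map (H ∸_) (map (z +_) F) ≡ map (H′ ∸_) F
  shifted = trans (sym (map-∘ F)) (map-cong (λ t → trans (cong (_∸ (z + t)) H≡) ([m+n]∸[m+o]≡n∸o z H′ t)) F)
  top : map (H ∸_) (replicate y z) ≡ replicate y H′
  top = trans (map-replicate (H ∸_) y z) (cong (replicate y) (trans (cong (_∸ z) H≡) (m+n∸m≡n z H′)))

C-fromTypes : ∀ ms ps → length ms ≡ length ps → 0 < length ms → All (0 <_) ms → All (0 <_) ps →
  C (fromTypes ms ps) ≡ fromTypes (shrink ms) (shrink ps)
C-fromTypes (c ∷ cs) ps eq _ (0<c ∷ _) pp with initLast ps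
... | ps′ ∷ʳ′ x = begin
  C (fromTypes (c ∷ cs) (ps′ ∷ʳ x))
    ≡⟨ cong C (fromTypes-∷-∷ʳ c cs ps′ x) ⟩
  C (replicate c (sum (ps′ ∷ʳ x)) ++ fromTypes cs ps′)
    ≡⟨ C-block c (sum (ps′ ∷ʳ x)) (fromTypes cs ps′) 0<c below ⟩
  reverse (map (sum (ps′ ∷ʳ x) ∸_) (fromTypes cs ps′))
    ≡⟨ cong₂ (λ h l → reverse (map (h ∸_) (fromTypes l ps′))) (sum-∷ʳ ps′ x) (sym (reverse-involutive cs)) ⟩
  reverse (map ((x + sum ps′) ∸_) (fromTypes (reverse (reverse cs)) ps′))
    ≡⟨ complement-fromTypes x ps′ (reverse cs) (trans (length-reverse cs) length-cs) ⟩
  fromTypes (reverse cs) (shrink (ps′ ∷ʳ x))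
    ∎
  where
  open ≡-Reasoning
  length-cs : length cs ≡ length ps′
  length-cs = suc-injective (trans eq (length-∷ʳ ps′ x))
  0<x : 0 < x
  0<x with px ∷ [] ← ++⁻ʳ ps′ pp = px
  below : All (_< sum (ps′ ∷ʳ x)) (fromTypes cs ps′)
  below = All.map (λ p → subst (_ <_) (sym (sum-∷ʳ ps′ x)) (<-≤-trans (s≤s p) (+-monoˡ-≤ (sum ps′) 0<x)))
                  (fromTypes-≤ cs ps′)

filtration-fromTypes : ∀ k ms ps → length ms ≡ length ps → All (0 <_) ms → All (0 <_) ps → k < length ms →
  filtration (fromTypes ms ps) (suc k) ≡ replicate (star ms (suc k)) (star ps (suc k))
filtration-fromTypes zero ms ps eq pm pp _ =
  trans (rect-fromTypes ms ps eq pm) (sym (cong₂ replicate (star-1 ms) (star-1 ps)))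
filtration-fromTypes (suc k) ms ps eq pm pp k<l = begin
  rect (iterC (suc k) (fromTypes ms ps))
    ≡⟨ cong rect (iterC-suc k (fromTypes ms ps)) ⟩
  filtration (C (fromTypes ms ps)) (suc k)
    ≡⟨ cong (λ L → filtration L (suc k)) (C-fromTypes ms ps eq (<-trans z<s k<l) pm pp) ⟩
  filtration (fromTypes (shrink ms) (shrink ps)) (suc k)
    ≡⟨ filtration-fromTypes k (shrink ms) (shrink ps) eq′ (All-shrink ms pm) (All-shrink ps pp) k<l′ ⟩
  replicate (star (shrink ms) (suc k)) (star (shrink ps) (suc k))
    ≡⟨ cong₂ replicate (star-suc-suc ms k) (star-suc-suc ps k) ⟨
  replicate (star ms (suc (suc k))) (star ps (suc (suc k)))
    ∎
  where
  open ≡-Reasoning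
  eq′ : length (shrink ms) ≡ length (shrink ps)
  eq′ = trans (length-shrink ms) (trans (cong (_∸ 1) eq) (sym (length-shrink ps)))
  k<l′ : k < length (shrink ms)
  k<l′ = subst (k <_) (sym (length-shrink ms)) (∸-monoˡ-≤ 1 k<l)

-- The partition (a₁^{n₁} ⋯ aₛ^{nₛ})

blocks : List ℕ → List ℕ → List ℕ
blocks []       _        = []
blocks (_ ∷ _)  []       = []
blocks (a ∷ as) (m ∷ ms) = replicate m a ++ blocks as ms

build≡blocks : ∀ {s} (a n : Fin s → ℕ) → build a n ≡ blocks (map a (allFin s)) (map n (allFin s))
build≡blocks {s} a n = go (allFin s)
  where
  go : ∀ is → concat (map (λ i → replicate (n i) (a i)) is) ≡ blocks (map a is) (map n is)
  go []       = refl
  go (i ∷ is) = cong (replicate (n i) (a i) ++_) (go is)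

gaps : List ℕ → List ℕ
gaps []          = []
gaps (x ∷ [])    = x ∷ []
gaps (x ∷ y ∷ r) = (x ∸ y) ∷ gaps (y ∷ r)

length-gaps : ∀ as → length (gaps as) ≡ length as
length-gaps []          = refl
length-gaps (x ∷ [])    = refl
length-gaps (x ∷ y ∷ r) = cong suc (length-gaps (y ∷ r))

sum-gaps : ∀ x xs → Linked _≥_ (x ∷ xs) → sum (gaps (x ∷ xs)) ≡ x
sum-gaps x []      _           = +-identityʳ x
sum-gaps x (y ∷ r) (y≤x ∷ ord) = trans (cong (x ∸ y +_) (sum-gaps y r ord)) (m∸n+n≡m y≤x)

gaps-positive : ∀ as → Linked _>_ as → All (0 <_) as → All (0 <_) (gaps as)
gaps-positive []          _           _          = []
gaps-positive (x ∷ [])    _           pas        = pas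
gaps-positive (x ∷ y ∷ r) (y<x ∷ ord) (_ ∷ pas) = m<n⇒0<n∸m y<x ∷ gaps-positive (y ∷ r) ord pas

fromGaps-gaps : ∀ as ms → Linked _≥_ as → fromGaps (gaps as) ms ≡ blocks as ms
fromGaps-gaps []          ms       _   = refl
fromGaps-gaps (x ∷ [])    []       _   = refl
fromGaps-gaps (x ∷ [])    (m ∷ ms) _   = cong (λ h → replicate m h ++ []) (+-identityʳ x)
fromGaps-gaps (x ∷ y ∷ r) []       _   = refl
fromGaps-gaps (x ∷ y ∷ r) (m ∷ ms) ord@(_ ∷ ord′) =
  cong₂ (λ h l → replicate m h ++ l) (sum-gaps x (y ∷ r) ord) (fromGaps-gaps (y ∷ r) ms ord′)

blocks≡fromTypes : ∀ as ms → Linked _≥_ as → blocks as ms ≡ fromTypes ms (reverse (gaps as))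
blocks≡fromTypes as ms ord =
  trans (sym (fromGaps-gaps as ms ord)) (cong (λ ds → fromGaps ds ms) (sym (reverse-involutive (gaps as))))

Linked-tabulate : ∀ s (a : Fin s → ℕ) → (∀ (i j : Fin s) → toℕ i < toℕ j → a j < a i) → Linked _>_ (tabulate a)
Linked-tabulate zero          a dec = []
Linked-tabulate (suc zero)    a dec = [-]
Linked-tabulate (suc (suc s)) a dec =
  dec fzero (fsuc fzero) z<s ∷ Linked-tabulate (suc s) (a ∘ fsuc) (λ i j i<j → dec (fsuc i) (fsuc j) (s<s i<j))

filtration-blocks : ∀ k as ms → Linked _>_ as → All (0 <_) as → All (0 <_) ms → length as ≡ length ms →
  k < length ms →
  filtration (blocks as ms) (suc k) ≡ replicate (star ms (suc k)) (star (multType (conj (blocks as ms))) (suc k))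
filtration-blocks k as ms decreasing pas pms length-as k<s = begin
  filtration (blocks as ms) (suc k)
    ≡⟨ cong (λ L → filtration L (suc k)) blocks≡ ⟩
  filtration (fromTypes ms ps) (suc k)
    ≡⟨ filtration-fromTypes k ms ps length-ms pms pps k<s ⟩
  replicate (star ms (suc k)) (star ps (suc k))
    ≡⟨ cong (λ p → replicate (star ms (suc k)) (star p (suc k))) conjugate-type ⟨
  replicate (star ms (suc k)) (star (multType (conj (blocks as ms))) (suc k))
    ∎
  where
  open ≡-Reasoning
  ps = reverse (gaps as)
  blocks≡ : blocks as ms ≡ fromTypes ms ps
  blocks≡ = blocks≡fromTypes as ms (Linked.map <⇒≤ decreasing)
  length-ms : length ms ≡ length ps
  length-ms = sym (trans (length-reverse (gaps as)) (trans (length-gaps as) length-as))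
  pps : All (0 <_) ps
  pps = All-reverse (gaps as) (gaps-positive as decreasing pas)
  conjugate-type : multType (conj (blocks as ms)) ≡ ps
  conjugate-type = begin
    multType (conj (blocks as ms))       ≡⟨ cong (multType ∘ conj) blocks≡ ⟩
    multType (conj (fromTypes ms ps))    ≡⟨ cong multType (conj-fromTypes ms ps length-ms pms) ⟩
    multType (fromTypes ps ms)           ≡⟨ multType-fromTypes ps ms (sym length-ms) pps pms ⟩
    ps                                   ∎

proposition4p20 : (s : ℕ) (a n : Fin s → ℕ)
    → (∀ (i j : Fin s) → toℕ i < toℕ j → a j < a i)
    → (∀ (i : Fin s) → 0 < a i)
    → (∀ (i : Fin s) → 0 < n i)
    → (i : Fin s)
    → filtration (build a n) (suc (toℕ i))
      ≡ replicate (star (map n (allFin s)) (suc (toℕ i)))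
                  (star (multType (conj (build a n))) (suc (toℕ i)))
proposition4p20 s a n a-decreasing a-positive n-positive i rewrite build≡blocks a n =
  filtration-blocks (toℕ i) as ns decreasing (map⁺ (tabulate⁺ a-positive)) (map⁺ (tabulate⁺ n-positive))
                    (trans (length-map a (allFin s)) (sym (length-map n (allFin s))))
                    (subst (toℕ i <_) (sym (trans (length-map n (allFin s)) (length-tabulate id))) (toℕ<n i))
  where
  as = map a (allFin s)
  ns = map n (allFin s)
  decreasing : Linked _>_ as
  decreasing = subst (Linked _>_) (sym (map-tabulate id a)) (Linked-tabulate s a a-decreasing)
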